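{- Among the solutions $(X,Y,Z)\in\mathbb{Z}[i]^3$ of $X^2+iY^2=(1+i)Z^2$ with $\gcd(X,Y)\in U$ and $XYZ\neq0$ there are solutions of the parametric form $$X=P^2-(1+i)iQ^2,\quad Y=P^2-2(1+i)PQ+(1+i)iQ^2,\quad Z=P^2-2iPQ+(1+i)iQ^2,$$ where $P,Q\in G$, $\gcd(P,Q)=1$ and $Q\equiv0\pmod{1+i}$.
   Context: $\mathbb{Z}[i]$ is the ring of Gaussian integers and $U=\{1,-1,i,-i\}$ its unit group. For $\alpha\in\mathbb{Z}[i]$, $R(\alpha)$ and $I(\alpha)$ denote its real and imaginary parts. $O^I=\{\alpha\in\mathbb{Z}[i]: R(\alpha)+I(\alpha)\equiv 1 \pmod 2,\ R(\alpha)\equiv 1 \pmod 4\}$. $G$ denotes the set of Gaussian integers of the form $(1+i)^{a_1}p_2^{a_2}\cdots p_m^{a_m}$ with integers $a_j\ge 0$ and $p_2,\dots,p_m$ distinct Gaussian primes belonging to $O^I$ (the empty product $1$ included). Congruences modulo $\mu$ mean divisibility by $\mu$ in $\mathbb{Z}[i]$; "$\gcd(\cdot)=1$" or "$\in U$" means no common non-unit divisor. -}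

module Defs where

open import Data.Integer as ℤ using (ℤ; +_; -[1+_]; 0ℤ; 1ℤ)
open import Data.Nat using (ℕ; zero; suc)
open import Data.List using (List; []; _∷_; map; foldr)
open import Data.List.Relation.Unary.All using (All)
open import Data.List.Relation.Unary.Unique.Propositional using (Unique)
open import Data.Product using (Σ; ∃; ∃-syntax; _×_; _,_; proj₁; proj₂)
open import Data.Sum using (_⊎_)
open import Relation.Binary.PropositionalEquality using (_≡_)
open import Relation.Nullary using (¬_)

record GI : Set where
  constructor mkGI
  field
    re : ℤ
    im : ℤ
open GI public

infixl 6 _+G_ _-G_
infixl 7 _*G_
infix 4 _∣G_

_+G_ : GI → GI → GI
mkGI a b +G mkGI c d = mkGI (a ℤ.+ c) (b ℤ.+ d)

-G_ : GI → GI
-G mkGI a b = mkGI (ℤ.- a) (ℤ.- b)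

_-G_ : GI → GI → GI
x -G y = x +G (-G y)

_*G_ : GI → GI → GI
mkGI a b *G mkGI c d = mkGI (a ℤ.* c ℤ.- b ℤ.* d) (a ℤ.* d ℤ.+ b ℤ.* c)

0G 1G iG : GI
0G = mkGI 0ℤ 0ℤ
1G = mkGI 1ℤ 0ℤ
iG = mkGI 0ℤ 1ℤ

1+iG : GI
1+iG = mkGI 1ℤ 1ℤ

_^G_ : GI → ℕ → GI
x ^G zero = 1G
x ^G suc n = x *G (x ^G n)

_∣G_ : GI → GI → Set
μ ∣G α = ∃[ κ ] (α ≡ κ *G μ)

InU : GI → Set
InU x = (x ≡ 1G) ⊎ (x ≡ -G 1G) ⊎ (x ≡ iG) ⊎ (x ≡ -G iG)

GPrime : GI → Set
GPrime p = ¬ (p ≡ 0G) × ¬ InU p ×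
           (∀ β γ → p ≡ β *G γ → InU β ⊎ InU γ)

InOI : GI → Set
InOI α = (∃[ k ] (re α ℤ.+ im α ≡ 1ℤ ℤ.+ (+ 2) ℤ.* k))
       × (∃[ k ] (re α ≡ 1ℤ ℤ.+ (+ 4) ℤ.* k))

prodG : List GI → GI
prodG = foldr _*G_ 1G

InG : GI → Set
InG x = Σ ℕ λ a₁ → Σ (List (GI × ℕ)) λ ps →
        Unique (map proj₁ ps)
      × All (λ pe → GPrime (proj₁ pe) × InOI (proj₁ pe)) ps
      × (x ≡ (1+iG ^G a₁) *G prodG (map (λ pe → proj₁ pe ^G proj₂ pe) ps))

CoprimeG : GI → GI → Set
CoprimeG α β = ∀ δ → δ ∣G α → δ ∣G β → InU δ

2+2iG -1+iG 2iG : GI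
2+2iG = mkGI (+ 2) (+ 2)
-1+iG = mkGI (ℤ.- 1ℤ) 1ℤ   -- (1+i) i
2iG   = mkGI 0ℤ (+ 2)

Xp Yp Zp : GI → GI → GI
Xp P Q = P *G P -G -1+iG *G Q *G Q
Yp P Q = P *G P -G 2+2iG *G P *G Q +G -1+iG *G Q *G Q
Zp P Q = P *G P -G 2iG *G P *G Q +G -1+iG *G Q *G Q

-- P is odd, i.e. P ≡ 1 (mod 1 + i), because (1 + i) ∣ Q and gcd(P, Q) = 1; hence X ≡ Y ≡ Z ≡ P² ≡ 1
-- are odd and XYZ ≠ 0, while X² + iY² = (1 + i)Z² is a polynomial identity in P and Q. A common
-- divisor of X and Y divides (1 + i)⁴P⁴ and (1 + i)⁴Q⁴ (explicit combinations of X and Y), hence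
-- (1 + i)⁴ by Bézout's identity for P and Q in the Euclidean ring ℤ[i]; being also a divisor of the
-- odd X, it is a unit.

module Submission where

open import Defs
open import Data.Empty using (⊥-elim)
open import Data.Integer as ℤ using (ℤ; +_; -[1+_]; 0ℤ; 1ℤ; ∣_∣)
import Data.Integer.DivMod as ℤ
import Data.Integer.Properties as ℤ
open import Data.Integer.Tactic.RingSolver using (solve-∀)
open import Data.Maybe using (Maybe; just; nothing)
open import Data.Nat as ℕ using (ℕ; zero; suc; _≤_; _<_; s≤s; z<s; NonZero)
open import Data.Nat.Induction using (<-wellFounded)
open import Data.Nat.Properties
import Data.Nat.Tactic.RingSolver as ℕSolver
open import Data.Product using (_×_; ∃; ∃₂; _,_; proj₁; proj₂)
open import Data.Sum using (_⊎_; inj₁; inj₂)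
open import Induction.WellFounded using (Acc; acc)
open import Level using (0ℓ)
open import Relation.Binary.PropositionalEquality
open import Relation.Nullary using (¬_; Dec; yes; no)
open import Relation.Nullary.Decidable using (map′)
open import Algebra.Structures {A = GI} _≡_
open import Algebra.Structures.Biased {A = GI} _≡_
open import Tactic.RingSolver.Core.AlmostCommutativeRing using (AlmostCommutativeRing)
import Tactic.RingSolver as RingSolver

mkGI-cong : ∀ {a b c d} → a ≡ c → b ≡ d → mkGI a b ≡ mkGI c d
mkGI-cong refl refl = refl

+G-assoc : ∀ x y z → (x +G y) +G z ≡ x +G (y +G z)
+G-assoc (mkGI a b) (mkGI c d) (mkGI e f) = mkGI-cong (ℤ.+-assoc a c e) (ℤ.+-assoc b d f)

+G-comm : ∀ x y → x +G y ≡ y +G x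
+G-comm (mkGI a b) (mkGI c d) = mkGI-cong (ℤ.+-comm a c) (ℤ.+-comm b d)

+G-identityˡ : ∀ x → 0G +G x ≡ x
+G-identityˡ (mkGI a b) = mkGI-cong (ℤ.+-identityˡ a) (ℤ.+-identityˡ b)

*G-assoc : ∀ x y z → (x *G y) *G z ≡ x *G (y *G z)
*G-assoc (mkGI a b) (mkGI c d) (mkGI e f) = mkGI-cong (re-law a b c d e f) (im-law a b c d e f)
  where
  re-law : ∀ a b c d e f → (a ℤ.* c ℤ.- b ℤ.* d) ℤ.* e ℤ.- (a ℤ.* d ℤ.+ b ℤ.* c) ℤ.* f
                         ≡ a ℤ.* (c ℤ.* e ℤ.- d ℤ.* f) ℤ.- b ℤ.* (c ℤ.* f ℤ.+ d ℤ.* e)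
  re-law = solve-∀
  im-law : ∀ a b c d e f → (a ℤ.* c ℤ.- b ℤ.* d) ℤ.* f ℤ.+ (a ℤ.* d ℤ.+ b ℤ.* c) ℤ.* e
                         ≡ a ℤ.* (c ℤ.* f ℤ.+ d ℤ.* e) ℤ.+ b ℤ.* (c ℤ.* e ℤ.- d ℤ.* f)
  im-law = solve-∀

*G-comm : ∀ x y → x *G y ≡ y *G x
*G-comm (mkGI a b) (mkGI c d) = mkGI-cong (re-law a b c d) (im-law a b c d)
  where
  re-law : ∀ a b c d → a ℤ.* c ℤ.- b ℤ.* d ≡ c ℤ.* a ℤ.- d ℤ.* b
  re-law = solve-∀
  im-law : ∀ a b c d → a ℤ.* d ℤ.+ b ℤ.* c ≡ c ℤ.* b ℤ.+ d ℤ.* a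
  im-law = solve-∀

*G-identityˡ : ∀ x → 1G *G x ≡ x
*G-identityˡ (mkGI a b) = mkGI-cong (re-law a b) (im-law a b)
  where
  re-law : ∀ a b → 1ℤ ℤ.* a ℤ.- 0ℤ ℤ.* b ≡ a
  re-law = solve-∀
  im-law : ∀ a b → 1ℤ ℤ.* b ℤ.+ 0ℤ ℤ.* a ≡ b
  im-law = solve-∀

*G-zeroˡ : ∀ x → 0G *G x ≡ 0G
*G-zeroˡ (mkGI a b) = mkGI-cong (re-law a b) (im-law a b)
  where
  re-law : ∀ a b → 0ℤ ℤ.* a ℤ.- 0ℤ ℤ.* b ≡ 0ℤ
  re-law = solve-∀
  im-law : ∀ a b → 0ℤ ℤ.* b ℤ.+ 0ℤ ℤ.* a ≡ 0ℤ
  im-law = solve-∀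

*G-distribʳ : ∀ x y z → (y +G z) *G x ≡ (y *G x) +G (z *G x)
*G-distribʳ (mkGI a b) (mkGI c d) (mkGI e f) = mkGI-cong (re-law a b c d e f) (im-law a b c d e f)
  where
  re-law : ∀ a b c d e f → (c ℤ.+ e) ℤ.* a ℤ.- (d ℤ.+ f) ℤ.* b
                         ≡ (c ℤ.* a ℤ.- d ℤ.* b) ℤ.+ (e ℤ.* a ℤ.- f ℤ.* b)
  re-law = solve-∀
  im-law : ∀ a b c d e f → (c ℤ.+ e) ℤ.* b ℤ.+ (d ℤ.+ f) ℤ.* a
                         ≡ (c ℤ.* b ℤ.+ d ℤ.* a) ℤ.+ (e ℤ.* b ℤ.+ f ℤ.* a)
  im-law = solve-∀

-G-*G-distribˡ : ∀ x y → (-G x) *G y ≡ -G (x *G y)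
-G-*G-distribˡ (mkGI a b) (mkGI c d) = mkGI-cong (re-law a b c d) (im-law a b c d)
  where
  re-law : ∀ a b c d → (ℤ.- a) ℤ.* c ℤ.- (ℤ.- b) ℤ.* d ≡ ℤ.- (a ℤ.* c ℤ.- b ℤ.* d)
  re-law = solve-∀
  im-law : ∀ a b c d → (ℤ.- a) ℤ.* d ℤ.+ (ℤ.- b) ℤ.* c ≡ ℤ.- (a ℤ.* d ℤ.+ b ℤ.* c)
  im-law = solve-∀

-G-+G-comm : ∀ x y → (-G x) +G (-G y) ≡ -G (x +G y)
-G-+G-comm (mkGI a b) (mkGI c d) = mkGI-cong (sym (ℤ.neg-distrib-+ a c)) (sym (ℤ.neg-distrib-+ b d))

GI-isCommutativeSemiring : IsCommutativeSemiring _+G_ _*G_ 0G 1G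
GI-isCommutativeSemiring = IsCommutativeSemiringˡ.isCommutativeSemiring record
  { +-isCommutativeMonoid = IsCommutativeMonoidˡ.isCommutativeMonoid record
      { isSemigroup = isSemigroup +G-assoc ; identityˡ = +G-identityˡ ; comm = +G-comm }
  ; *-isCommutativeMonoid = IsCommutativeMonoidˡ.isCommutativeMonoid record
      { isSemigroup = isSemigroup *G-assoc ; identityˡ = *G-identityˡ ; comm = *G-comm }
  ; distribʳ = *G-distribʳ
  ; zeroˡ = *G-zeroˡ
  }
  where
  isSemigroup : ∀ {_∙_} → (∀ x y z → (x ∙ y) ∙ z ≡ x ∙ (y ∙ z)) → IsSemigroup _∙_
  isSemigroup assoc = record
    { isMagma = record { isEquivalence = isEquivalence ; ∙-cong = cong₂ _ } ; assoc = assoc }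

0G≟ : (x : GI) → Maybe (0G ≡ x)
0G≟ (mkGI (+ 0) (+ 0)) = just refl
0G≟ _ = nothing

GI-ring : AlmostCommutativeRing 0ℓ 0ℓ
GI-ring = record
  { Carrier = GI ; _≈_ = _≡_ ; _+_ = _+G_ ; _*_ = _*G_ ; -_ = (-G_)
  ; 0# = 0G ; 1# = 1G ; 0≟_ = 0G≟
  ; isAlmostCommutativeRing = record
    { isCommutativeSemiring = GI-isCommutativeSemiring
    ; -‿cong = cong (-G_)
    ; -‿*-distribˡ = -G-*G-distribˡ
    ; -‿+-comm = -G-+G-comm
    }
  }

∣G-linear : ∀ {δ a b} c d → δ ∣G a → δ ∣G b → δ ∣G c *G a +G d *G b
∣G-linear {δ} c d (x , refl) (y , refl) = c *G x +G d *G y , law c x δ d y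
  where
  law : ∀ c x δ d y → c *G (x *G δ) +G d *G (y *G δ) ≡ (c *G x +G d *G y) *G δ
  law = RingSolver.solve-∀ GI-ring

∣G-*ˡ : ∀ {δ a} c → δ ∣G a → δ ∣G c *G a
∣G-*ˡ {δ} c (x , refl) = c *G x , sym (*G-assoc c x δ)

∣G-neg : ∀ {δ a} → δ ∣G a → δ ∣G -G a
∣G-neg {δ} (x , refl) = -G x , sym (-G-*G-distribˡ x δ)

∣G-resp-≡ : ∀ {δ a b} → a ≡ b → δ ∣G a → δ ∣G b
∣G-resp-≡ refl δ∣a = δ∣a

unit-invertible : ∀ {u} → InU u → ∃ λ v → v *G u ≡ 1G
unit-invertible (inj₁ refl) = 1G , refl
unit-invertible (inj₂ (inj₁ refl)) = -G 1G , refl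
unit-invertible (inj₂ (inj₂ (inj₁ refl))) = -G iG , refl
unit-invertible (inj₂ (inj₂ (inj₂ refl))) = iG , refl

1+i-nonunit : ¬ InU 1+iG
1+i-nonunit (inj₁ ())
1+i-nonunit (inj₂ (inj₁ ()))
1+i-nonunit (inj₂ (inj₂ (inj₁ ())))
1+i-nonunit (inj₂ (inj₂ (inj₂ ())))

conjG : GI → GI
conjG (mkGI a b) = mkGI a (ℤ.- b)

∣_∣² : ℤ → ℕ
∣ a ∣² = ∣ a ∣ ℕ.* ∣ a ∣

norm : GI → ℕ
norm (mkGI a b) = ∣ a ∣² ℕ.+ ∣ b ∣²

normℤ : GI → ℤ
normℤ (mkGI a b) = a ℤ.* a ℤ.+ b ℤ.* b

+∣a∣²≡a*a : ∀ a → + ∣ a ∣² ≡ a ℤ.* a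
+∣a∣²≡a*a (+ n) = ℤ.pos-* n n
+∣a∣²≡a*a -[1+ n ] = refl

+norm≡normℤ : ∀ x → + norm x ≡ normℤ x
+norm≡normℤ (mkGI a b) = trans (ℤ.pos-+ ∣ a ∣² ∣ b ∣²) (cong₂ ℤ._+_ (+∣a∣²≡a*a a) (+∣a∣²≡a*a b))

normℤ-* : ∀ x y → normℤ (x *G y) ≡ normℤ x ℤ.* normℤ y
normℤ-* (mkGI a b) (mkGI c d) = law a b c d
  where
  law : ∀ a b c d → (a ℤ.* c ℤ.- b ℤ.* d) ℤ.* (a ℤ.* c ℤ.- b ℤ.* d) ℤ.+ (a ℤ.* d ℤ.+ b ℤ.* c) ℤ.* (a ℤ.* d ℤ.+ b ℤ.* c)
                  ≡ (a ℤ.* a ℤ.+ b ℤ.* b) ℤ.* (c ℤ.* c ℤ.+ d ℤ.* d)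
  law = solve-∀

norm-* : ∀ x y → norm (x *G y) ≡ norm x ℕ.* norm y
norm-* x y = ℤ.+-injective (begin
  + norm (x *G y)         ≡⟨ +norm≡normℤ (x *G y) ⟩
  normℤ (x *G y)          ≡⟨ normℤ-* x y ⟩
  normℤ x ℤ.* normℤ y     ≡⟨ sym (cong₂ ℤ._*_ (+norm≡normℤ x) (+norm≡normℤ y)) ⟩
  + norm x ℤ.* + norm y   ≡⟨ sym (ℤ.pos-* (norm x) (norm y)) ⟩
  + (norm x ℕ.* norm y)   ∎)
  where open ≡-Reasoning

norm-conjG : ∀ x → norm (conjG x) ≡ norm x
norm-conjG (mkGI a b) = cong (λ n → ∣ a ∣² ℕ.+ n ℕ.* n) (ℤ.∣-i∣≡∣i∣ b)

*G-conjG : ∀ x → x *G conjG x ≡ mkGI (+ norm x) 0ℤ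
*G-conjG (mkGI a b) = mkGI-cong (trans (re-law a b) (sym (+norm≡normℤ (mkGI a b)))) (im-law a b)
  where
  re-law : ∀ a b → a ℤ.* a ℤ.- b ℤ.* (ℤ.- b) ≡ a ℤ.* a ℤ.+ b ℤ.* b
  re-law = solve-∀
  im-law : ∀ a b → a ℤ.* (ℤ.- b) ℤ.+ b ℤ.* a ≡ 0ℤ
  im-law = solve-∀

norm≡0⇒≡0G : ∀ x → norm x ≡ 0 → x ≡ 0G
norm≡0⇒≡0G (mkGI (+ zero) (+ zero)) _ = refl
norm≡0⇒≡0G (mkGI (+ zero) (+ suc n)) ()
norm≡0⇒≡0G (mkGI (+ zero) -[1+ n ]) ()
norm≡0⇒≡0G (mkGI (+ suc m) b) ()
norm≡0⇒≡0G (mkGI -[1+ m ] b) ()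

norm≡1⇒unit : ∀ x → norm x ≡ 1 → InU x
norm≡1⇒unit (mkGI (+ zero) (+ zero)) ()
norm≡1⇒unit (mkGI (+ zero) (+ suc zero)) _ = inj₂ (inj₂ (inj₁ refl))
norm≡1⇒unit (mkGI (+ zero) (+ suc (suc n))) ()
norm≡1⇒unit (mkGI (+ zero) -[1+ zero ]) _ = inj₂ (inj₂ (inj₂ refl))
norm≡1⇒unit (mkGI (+ zero) -[1+ suc n ]) ()
norm≡1⇒unit (mkGI (+ suc zero) (+ zero)) _ = inj₁ refl
norm≡1⇒unit (mkGI (+ suc zero) (+ suc n)) ()
norm≡1⇒unit (mkGI (+ suc zero) -[1+ n ]) ()
norm≡1⇒unit (mkGI (+ suc (suc m)) b) ()
norm≡1⇒unit (mkGI -[1+ zero ] (+ zero)) _ = inj₂ (inj₁ refl)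
norm≡1⇒unit (mkGI -[1+ zero ] (+ suc n)) ()
norm≡1⇒unit (mkGI -[1+ zero ] -[1+ n ]) ()
norm≡1⇒unit (mkGI -[1+ suc m ] b) ()

∣G1G⇒unit : ∀ {δ} → δ ∣G 1G → InU δ
∣G1G⇒unit {δ} (κ , 1≡κδ) =
  norm≡1⇒unit δ (m*n≡1⇒n≡1 (norm κ) (norm δ) (trans (sym (norm-* κ δ)) (cong norm (sym 1≡κδ))))

2*m≤n⇒m<n : ∀ {m n} .{{_ : NonZero n}} → 2 ℕ.* m ≤ n → m < n
2*m≤n⇒m<n {zero} {n} _ = ℕ.>-nonZero⁻¹ n
2*m≤n⇒m<n {suc m} 2m≤n = <-≤-trans (m<m+n (suc m) z<s) 2m≤n

remainder-centred : ∀ d r → r < d → ∃₂ λ c e → + r ≡ c ℤ.* + d ℤ.+ e × 2 ℕ.* ∣ e ∣ ≤ d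
remainder-centred d r r<d with 2 ℕ.* r ≤? d
... | yes 2r≤d = 0ℤ , + r , refl , 2r≤d
... | no 2r≰d = 1ℤ , ℤ.- + k , +r≡d-k , 2∣e∣≤d
  where
  k : ℕ
  k = d ℕ.∸ r
  k+r≡d : k ℕ.+ r ≡ d
  k+r≡d = m∸n+n≡m (<⇒≤ r<d)
  +r≡d-k : + r ≡ 1ℤ ℤ.* + d ℤ.+ ℤ.- + k
  +r≡d-k = trans (law (+ k) (+ r))
    (cong (λ n → 1ℤ ℤ.* n ℤ.+ ℤ.- + k) (trans (sym (ℤ.pos-+ k r)) (cong +_ k+r≡d)))
    where
    law : ∀ k r → r ≡ 1ℤ ℤ.* (k ℤ.+ r) ℤ.+ ℤ.- k
    law = solve-∀
  k<r : k < r
  k<r = +-cancelʳ-< r k r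
    (subst₂ _<_ (sym k+r≡d) (cong (r ℕ.+_) (+-identityʳ r)) (≰⇒> 2r≰d))
  2∣e∣≤d : 2 ℕ.* ∣ ℤ.- + k ∣ ≤ d
  2∣e∣≤d rewrite ℤ.∣-i∣≡∣i∣ (+ k) =
    subst₂ _≤_ (cong (k ℕ.+_) (sym (+-identityʳ k))) k+r≡d (+-monoʳ-≤ k (<⇒≤ k<r))

centred-division : ∀ a d .{{_ : NonZero d}} → ∃₂ λ q e → a ≡ q ℤ.* + d ℤ.+ e × 2 ℕ.* ∣ e ∣ ≤ d
centred-division a d with remainder-centred d (a ℤ.%ℕ d) (ℤ.n%ℕd<d a d)
... | c , e , r≡cd+e , bound = c ℤ.+ a ℤ./ℕ d , e , a≡qd+e , bound
  where
  a≡qd+e : a ≡ (c ℤ.+ a ℤ./ℕ d) ℤ.* + d ℤ.+ e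
  a≡qd+e = trans (ℤ.a≡a%ℕn+[a/ℕn]*n a d)
    (trans (cong (ℤ._+ (a ℤ./ℕ d) ℤ.* + d) r≡cd+e) (law c (a ℤ./ℕ d) (+ d) e))
    where
    law : ∀ c q d e → (c ℤ.* d ℤ.+ e) ℤ.+ q ℤ.* d ≡ (c ℤ.+ q) ℤ.* d ℤ.+ e
    law = solve-∀

norm<-from-centred-conj-product : ∀ r β {e₁ e₂} .{{_ : NonZero (norm β)}} → r *G conjG β ≡ mkGI e₁ e₂
  → 2 ℕ.* ∣ e₁ ∣ ≤ norm β → 2 ℕ.* ∣ e₂ ∣ ≤ norm β → norm r < norm β
norm<-from-centred-conj-product r β {e₁} {e₂} r*conjβ 2∣e₁∣≤n 2∣e₂∣≤n =
  2*m≤n⇒m<n (*-cancelʳ-≤ (2 ℕ.* norm r) n (2 ℕ.* n) {{m*n≢0 2 n}} bound)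
  where
  n : ℕ
  n = norm β
  r*conjβ-norm : norm r ℕ.* n ≡ ∣ e₁ ∣² ℕ.+ ∣ e₂ ∣²
  r*conjβ-norm = begin
    norm r ℕ.* n              ≡⟨ cong (norm r ℕ.*_) (sym (norm-conjG β)) ⟩
    norm r ℕ.* norm (conjG β) ≡⟨ sym (norm-* r (conjG β)) ⟩
    norm (r *G conjG β)       ≡⟨ cong norm r*conjβ ⟩
    ∣ e₁ ∣² ℕ.+ ∣ e₂ ∣²        ∎
    where open ≡-Reasoning
  bound : 2 ℕ.* norm r ℕ.* (2 ℕ.* n) ≤ n ℕ.* (2 ℕ.* n)
  bound = begin
    2 ℕ.* norm r ℕ.* (2 ℕ.* n)                      ≡⟨ law₁ (norm r) n ⟩
    4 ℕ.* (norm r ℕ.* n)                             ≡⟨ cong (4 ℕ.*_) r*conjβ-norm ⟩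
    4 ℕ.* (∣ e₁ ∣ ℕ.* ∣ e₁ ∣ ℕ.+ ∣ e₂ ∣ ℕ.* ∣ e₂ ∣)  ≡⟨ law₂ ∣ e₁ ∣ ∣ e₂ ∣ ⟩
    2 ℕ.* ∣ e₁ ∣ ℕ.* (2 ℕ.* ∣ e₁ ∣) ℕ.+ 2 ℕ.* ∣ e₂ ∣ ℕ.* (2 ℕ.* ∣ e₂ ∣)
      ≤⟨ +-mono-≤ (*-mono-≤ 2∣e₁∣≤n 2∣e₁∣≤n) (*-mono-≤ 2∣e₂∣≤n 2∣e₂∣≤n) ⟩
    n ℕ.* n ℕ.+ n ℕ.* n                              ≡⟨ law₃ n ⟩
    n ℕ.* (2 ℕ.* n)                                  ∎
    where
    open ≤-Reasoning
    law₁ : ∀ m n → 2 ℕ.* m ℕ.* (2 ℕ.* n) ≡ 4 ℕ.* (m ℕ.* n)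
    law₁ = ℕSolver.solve-∀
    law₂ : ∀ a b → 4 ℕ.* (a ℕ.* a ℕ.+ b ℕ.* b) ≡ 2 ℕ.* a ℕ.* (2 ℕ.* a) ℕ.+ 2 ℕ.* b ℕ.* (2 ℕ.* b)
    law₂ = ℕSolver.solve-∀
    law₃ : ∀ n → n ℕ.* n ℕ.+ n ℕ.* n ≡ n ℕ.* (2 ℕ.* n)
    law₃ = ℕSolver.solve-∀

-- Dividing α · conj β by the integer norm β with centred remainders e₁, e₂ gives
-- (α − qβ) · conj β = e₁ + e₂ i, hence norm (α − qβ) · norm β = e₁² + e₂² ≤ (norm β)² / 2.
euclidean-division : ∀ α β → ¬ β ≡ 0G → ∃ λ q → norm (α -G q *G β) < norm β
euclidean-division α β β≢0 = mkGI q₁ q₂ ,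
  norm<-from-centred-conj-product r β r*conjβ
    (proj₂ (proj₂ (proj₂ re-division))) (proj₂ (proj₂ (proj₂ im-division)))
  where
  n : ℕ
  n = norm β
  instance
    n≢0 : NonZero n
    n≢0 = ℕ.≢-nonZero (λ n≡0 → β≢0 (norm≡0⇒≡0G β n≡0))
  γ : GI
  γ = α *G conjG β
  re-division : ∃₂ λ q e → re γ ≡ q ℤ.* + n ℤ.+ e × 2 ℕ.* ∣ e ∣ ≤ n
  re-division = centred-division (re γ) n
  im-division : ∃₂ λ q e → im γ ≡ q ℤ.* + n ℤ.+ e × 2 ℕ.* ∣ e ∣ ≤ n
  im-division = centred-division (im γ) n
  q₁ q₂ e₁ e₂ : ℤ
  q₁ = proj₁ re-division
  q₂ = proj₁ im-division
  e₁ = proj₁ (proj₂ re-division)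
  e₂ = proj₁ (proj₂ im-division)
  r : GI
  r = α -G mkGI q₁ q₂ *G β
  r*conjβ : r *G conjG β ≡ mkGI e₁ e₂
  r*conjβ = begin
    r *G conjG β
      ≡⟨ distrib α (mkGI q₁ q₂) β (conjG β) ⟩
    γ -G mkGI q₁ q₂ *G (β *G conjG β)
      ≡⟨ cong (λ z → γ -G mkGI q₁ q₂ *G z) (*G-conjG β) ⟩
    mkGI (re γ) (im γ) -G mkGI q₁ q₂ *G mkGI (+ n) 0ℤ
      ≡⟨ cong₂ (λ u v → mkGI u v -G mkGI q₁ q₂ *G mkGI (+ n) 0ℤ)
               (proj₁ (proj₂ (proj₂ re-division))) (proj₁ (proj₂ (proj₂ im-division))) ⟩
    mkGI (q₁ ℤ.* + n ℤ.+ e₁) (q₂ ℤ.* + n ℤ.+ e₂) -G mkGI q₁ q₂ *G mkGI (+ n) 0ℤ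
      ≡⟨ mkGI-cong (re-law q₁ q₂ (+ n) e₁) (im-law q₁ q₂ (+ n) e₂) ⟩
    mkGI e₁ e₂ ∎
    where
    open ≡-Reasoning
    distrib : ∀ α q β c → (α -G q *G β) *G c ≡ α *G c -G q *G (β *G c)
    distrib = RingSolver.solve-∀ GI-ring
    re-law : ∀ q₁ q₂ n e₁ → (q₁ ℤ.* n ℤ.+ e₁) ℤ.+ ℤ.- (q₁ ℤ.* n ℤ.- q₂ ℤ.* 0ℤ) ≡ e₁
    re-law = solve-∀
    im-law : ∀ q₁ q₂ n e₂ → (q₂ ℤ.* n ℤ.+ e₂) ℤ.+ ℤ.- (q₁ ℤ.* 0ℤ ℤ.+ q₂ ℤ.* n) ≡ e₂
    im-law = solve-∀

record BezoutGCD (α β : GI) : Set where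
  field
    gcd s t : GI
    gcd∣α : gcd ∣G α
    gcd∣β : gcd ∣G β
    gcd≡ : gcd ≡ s *G α +G t *G β

bezout-step : ∀ {α β} q → BezoutGCD β (α -G q *G β) → BezoutGCD α β
bezout-step {α} {β} q g = record
  { gcd = gcd ; s = t ; t = s -G t *G q
  ; gcd∣α = ∣G-resp-≡ (reconstruct α β q) (∣G-linear q 1G gcd∣α gcd∣β)
  ; gcd∣β = gcd∣α
  ; gcd≡ = trans gcd≡ (recombine s t α β q)
  }
  where
  open BezoutGCD g
  reconstruct : ∀ α β q → q *G β +G 1G *G (α -G q *G β) ≡ α
  reconstruct = RingSolver.solve-∀ GI-ring
  recombine : ∀ s t α β q → s *G β +G t *G (α -G q *G β) ≡ t *G α +G (s -G t *G q) *G β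
  recombine = RingSolver.solve-∀ GI-ring

≡0G? : ∀ x → Dec (x ≡ 0G)
≡0G? x = map′ (norm≡0⇒≡0G x) (cong norm) (norm x ℕ.≟ 0)

bezout-acc : ∀ α β → Acc _<_ (norm β) → BezoutGCD α β
bezout-acc α β (acc rec) with ≡0G? β
... | yes refl = record
  { gcd = α ; s = 1G ; t = 0G
  ; gcd∣α = 1G , sym (*G-identityˡ α)
  ; gcd∣β = 0G , sym (*G-zeroˡ α)
  ; gcd≡ = combination α
  }
  where
  combination : ∀ α → α ≡ 1G *G α +G 0G *G 0G
  combination = RingSolver.solve-∀ GI-ring
... | no β≢0 = divide (euclidean-division α β β≢0)
  where
  divide : ∃ (λ q → norm (α -G q *G β) < norm β) → BezoutGCD α β
  divide (q , r<β) = bezout-step q (bezout-acc β (α -G q *G β) (rec r<β))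

bezout : ∀ α β → BezoutGCD α β
bezout α β = bezout-acc α β (<-wellFounded (norm β))

BezoutCoprime : GI → GI → Set
BezoutCoprime a b = ∃₂ λ u v → 1G ≡ u *G a +G v *G b

coprime-gcd⇒bezoutCoprime : ∀ {a b} → CoprimeG a b → BezoutGCD a b → BezoutCoprime a b
coprime-gcd⇒bezoutCoprime {a} {b} coprime g = invert (unit-invertible (coprime gcd gcd∣α gcd∣β))
  where
  open BezoutGCD g
  distrib : ∀ v s a t b → v *G (s *G a +G t *G b) ≡ (v *G s) *G a +G (v *G t) *G b
  distrib = RingSolver.solve-∀ GI-ring
  invert : ∃ (λ v → v *G gcd ≡ 1G) → BezoutCoprime a b
  invert (v , v*gcd≡1) =
    v *G s , v *G t , trans (sym v*gcd≡1) (trans (cong (v *G_) gcd≡) (distrib v s a t b))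

coprime⇒bezoutCoprime : ∀ {a b} → CoprimeG a b → BezoutCoprime a b
coprime⇒bezoutCoprime {a} {b} coprime = coprime-gcd⇒bezoutCoprime coprime (bezout a b)

bezoutCoprime-sym : ∀ {a b} → BezoutCoprime a b → BezoutCoprime b a
bezoutCoprime-sym {a} {b} (u , v , 1≡) = v , u , trans 1≡ (+G-comm (u *G a) (v *G b))

bezoutCoprime-*ˡ : ∀ {a b c} → BezoutCoprime a b → BezoutCoprime c b → BezoutCoprime (a *G c) b
bezoutCoprime-*ˡ {a} {b} {c} (u , v , 1≡ua+vb) (u′ , v′ , 1≡u′c+v′b) =
  u *G u′ , u *G a *G v′ +G v *G u′ *G c +G v *G v′ *G b ,
  trans (cong₂ _*G_ 1≡ua+vb 1≡u′c+v′b) (expand u v a b u′ v′ c)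
  where
  expand : ∀ u v a b u′ v′ c → (u *G a +G v *G b) *G (u′ *G c +G v′ *G b)
         ≡ (u *G u′) *G (a *G c) +G (u *G a *G v′ +G v *G u′ *G c +G v *G v′ *G b) *G b
  expand = RingSolver.solve-∀ GI-ring

bezoutCoprime-*ʳ : ∀ {a b c} → BezoutCoprime a b → BezoutCoprime a c → BezoutCoprime a (b *G c)
bezoutCoprime-*ʳ ab ac = bezoutCoprime-sym (bezoutCoprime-*ˡ (bezoutCoprime-sym ab) (bezoutCoprime-sym ac))

bezoutCoprime⇒∣1G : ∀ {a b δ} → BezoutCoprime a b → δ ∣G a → δ ∣G b → δ ∣G 1G
bezoutCoprime⇒∣1G (u , v , 1≡) δ∣a δ∣b = ∣G-resp-≡ (sym 1≡) (∣G-linear u v δ∣a δ∣b)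

∣G-cancel-bezoutCoprime : ∀ {a b c δ} → BezoutCoprime a b → δ ∣G c *G a → δ ∣G c *G b → δ ∣G c
∣G-cancel-bezoutCoprime {a} {b} {c} (u , v , 1≡) δ∣ca δ∣cb =
  ∣G-resp-≡ (trans (regroup u v a b c) (trans (cong (c *G_) (sym 1≡)) (trans (*G-comm c 1G) (*G-identityˡ c))))
    (∣G-linear u v δ∣ca δ∣cb)
  where
  regroup : ∀ u v a b c → u *G (c *G a) +G v *G (c *G b) ≡ c *G (u *G a +G v *G b)
  regroup = RingSolver.solve-∀ GI-ring

Odd : GI → Set
Odd x = ∃ λ w → x ≡ 1G +G 1+iG *G w

ℤ-parity : ∀ z → ∃ λ k → z ≡ k ℤ.+ k ⊎ z ≡ k ℤ.+ k ℤ.+ 1ℤ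
ℤ-parity z with z ℤ.%ℕ 2 | ℤ.a≡a%ℕn+[a/ℕn]*n z 2 | ℤ.n%ℕd<d z 2
... | 0 | z≡ | _ = z ℤ./ℕ 2 , inj₁ (trans z≡ (law (z ℤ./ℕ 2)))
  where
  law : ∀ k → + 0 ℤ.+ k ℤ.* + 2 ≡ k ℤ.+ k
  law = solve-∀
... | 1 | z≡ | _ = z ℤ./ℕ 2 , inj₂ (trans z≡ (law (z ℤ./ℕ 2)))
  where
  law : ∀ k → + 1 ℤ.+ k ℤ.* + 2 ≡ k ℤ.+ k ℤ.+ 1ℤ
  law = solve-∀
... | suc (suc _) | _ | s≤s (s≤s ())

b≡c-a : ∀ {a b c} → a ℤ.+ b ≡ c → b ≡ c ℤ.- a
b≡c-a {a} {b} a+b≡c = trans (law a b) (cong (ℤ._- a) a+b≡c)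
  where
  law : ∀ a b → b ≡ (a ℤ.+ b) ℤ.- a
  law = solve-∀

-- a + bi is divisible by 1 + i exactly when a + b is even: if a + b = 2k then a + bi = (1 + i)(k + (k − a)i).
parity : ∀ α → 1+iG ∣G α ⊎ Odd α
parity (mkGI a b) with ℤ-parity (a ℤ.+ b)
... | k , inj₁ a+b≡2k =
  inj₁ (mkGI k (k ℤ.- a) , mkGI-cong (re-law a k) (trans (b≡c-a a+b≡2k) (im-law a k)))
  where
  re-law : ∀ a k → a ≡ k ℤ.* 1ℤ ℤ.- (k ℤ.- a) ℤ.* 1ℤ
  re-law = solve-∀
  im-law : ∀ a k → (k ℤ.+ k) ℤ.- a ≡ k ℤ.* 1ℤ ℤ.+ (k ℤ.- a) ℤ.* 1ℤ
  im-law = solve-∀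
... | k , inj₂ a+b≡2k+1 =
  inj₂ (mkGI k (k ℤ.- a ℤ.+ 1ℤ) , mkGI-cong (re-law a k) (trans (b≡c-a a+b≡2k+1) (im-law a k)))
  where
  re-law : ∀ a k → a ≡ 1ℤ ℤ.+ (1ℤ ℤ.* k ℤ.- 1ℤ ℤ.* (k ℤ.- a ℤ.+ 1ℤ))
  re-law = solve-∀
  im-law : ∀ a k → (k ℤ.+ k ℤ.+ 1ℤ) ℤ.- a ≡ 0ℤ ℤ.+ (1ℤ ℤ.* (k ℤ.- a ℤ.+ 1ℤ) ℤ.+ 1ℤ ℤ.* k)
  im-law = solve-∀

odd-* : ∀ {x y} → Odd x → Odd y → Odd (x *G y)
odd-* (v , refl) (w , refl) = v +G w +G 1+iG *G v *G w , expand v w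
  where
  expand : ∀ v w → (1G +G 1+iG *G v) *G (1G +G 1+iG *G w) ≡ 1G +G 1+iG *G (v +G w +G 1+iG *G v *G w)
  expand = RingSolver.solve-∀ GI-ring

odd-+ : ∀ {x y} → Odd x → 1+iG ∣G y → Odd (x +G y)
odd-+ (v , refl) (w , refl) = v +G w , regroup v w
  where
  regroup : ∀ v w → 1G +G 1+iG *G v +G w *G 1+iG ≡ 1G +G 1+iG *G (v +G w)
  regroup = RingSolver.solve-∀ GI-ring

odd⇒bezoutCoprime-1+i : ∀ {x} → Odd x → BezoutCoprime x 1+iG
odd⇒bezoutCoprime-1+i (w , refl) = 1G , -G w , law w
  where
  law : ∀ w → 1G ≡ 1G *G (1G +G 1+iG *G w) +G (-G w) *G 1+iG
  law = RingSolver.solve-∀ GI-ring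

odd⇒≢0G : ∀ {x} → Odd x → ¬ x ≡ 0G
odd⇒≢0G x-odd refl = 1+i-nonunit (∣G1G⇒unit (bezoutCoprime⇒∣1G (odd⇒bezoutCoprime-1+i x-odd) 1+i∣0 (1G , sym (*G-identityˡ 1+iG))))
  where
  1+i∣0 : 1+iG ∣G 0G
  1+i∣0 = 0G , sym (*G-zeroˡ 1+iG)

-- Each identity is proved in unfolded form, where the ring solver can see the variables P and Q.
parametrisation-solves : ∀ P Q → Xp P Q *G Xp P Q +G iG *G (Yp P Q *G Yp P Q) ≡ 1+iG *G (Zp P Q *G Zp P Q)
parametrisation-solves = unfolded
  where
  unfolded : ∀ P Q →
      (P *G P -G -1+iG *G Q *G Q) *G (P *G P -G -1+iG *G Q *G Q)
      +G iG *G ((P *G P -G 2+2iG *G P *G Q +G -1+iG *G Q *G Q) *G (P *G P -G 2+2iG *G P *G Q +G -1+iG *G Q *G Q))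
    ≡ 1+iG *G ((P *G P -G 2iG *G P *G Q +G -1+iG *G Q *G Q) *G (P *G P -G 2iG *G P *G Q +G -1+iG *G Q *G Q))
  unfolded = RingSolver.solve-∀ GI-ring

∣X∣Y⇒∣P⁴ : ∀ {δ} P Q → δ ∣G Xp P Q → δ ∣G Yp P Q
          → δ ∣G (1+iG *G 1+iG) *G (1+iG *G 1+iG) *G ((P *G P) *G (P *G P))
∣X∣Y⇒∣P⁴ P Q δ∣X δ∣Y = ∣G-resp-≡ (combination P Q)
  (∣G-linear (mkGI -[1+ 3 ] -[1+ 1 ] *G P *G P +G mkGI -[1+ 1 ] (+ 2) *G P *G Q)
             (2iG *G P *G P +G mkGI -[1+ 1 ] (+ 2) *G P *G Q) δ∣X δ∣Y)
  where
  combination : ∀ P Q →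
      (mkGI -[1+ 3 ] -[1+ 1 ] *G P *G P +G mkGI -[1+ 1 ] (+ 2) *G P *G Q) *G (P *G P -G -1+iG *G Q *G Q)
      +G (2iG *G P *G P +G mkGI -[1+ 1 ] (+ 2) *G P *G Q) *G (P *G P -G 2+2iG *G P *G Q +G -1+iG *G Q *G Q)
    ≡ (1+iG *G 1+iG) *G (1+iG *G 1+iG) *G ((P *G P) *G (P *G P))
  combination = RingSolver.solve-∀ GI-ring

∣X∣Y⇒∣Q⁴ : ∀ {δ} P Q → δ ∣G Xp P Q → δ ∣G Yp P Q
          → δ ∣G (1+iG *G 1+iG) *G (1+iG *G 1+iG) *G ((Q *G Q) *G (Q *G Q))
∣X∣Y⇒∣Q⁴ P Q δ∣X δ∣Y = ∣G-resp-≡ (combination P Q)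
  (∣G-linear (P *G P -G 1+iG *G P *G Q -G 2+2iG *G Q *G Q) (-G (P *G P +G 1+iG *G P *G Q)) δ∣X δ∣Y)
  where
  combination : ∀ P Q →
      (P *G P -G 1+iG *G P *G Q -G 2+2iG *G Q *G Q) *G (P *G P -G -1+iG *G Q *G Q)
      +G (-G (P *G P +G 1+iG *G P *G Q)) *G (P *G P -G 2+2iG *G P *G Q +G -1+iG *G Q *G Q)
    ≡ (1+iG *G 1+iG) *G (1+iG *G 1+iG) *G ((Q *G Q) *G (Q *G Q))
  combination = RingSolver.solve-∀ GI-ring

parametrisation-odd : ∀ {P Q} → Odd P → 1+iG ∣G Q → Odd (Xp P Q) × Odd (Yp P Q) × Odd (Zp P Q)
parametrisation-odd {P} {Q} P-odd 1+i∣Q =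
  minus (-1+iG *G Q) P²-odd ,
  plus (-1+iG *G Q) (minus (2+2iG *G P) P²-odd) ,
  plus (-1+iG *G Q) (minus (2iG *G P) P²-odd)
  where
  P²-odd : Odd (P *G P)
  P²-odd = odd-* P-odd P-odd
  plus : ∀ {x} c → Odd x → Odd (x +G c *G Q)
  plus c x-odd = odd-+ x-odd (∣G-*ˡ c 1+i∣Q)
  minus : ∀ {x} c → Odd x → Odd (x -G c *G Q)
  minus c x-odd = odd-+ x-odd (∣G-neg (∣G-*ˡ c 1+i∣Q))

parametrisation-coprime : ∀ {P Q} → BezoutCoprime P Q → Odd (Xp P Q) → CoprimeG (Xp P Q) (Yp P Q)
parametrisation-coprime {P} {Q} P⊥Q X-odd δ δ∣X δ∣Y =
  ∣G1G⇒unit (bezoutCoprime⇒∣1G X⊥μ δ∣X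
    (∣G-cancel-bezoutCoprime P⁴⊥Q⁴ (∣X∣Y⇒∣P⁴ P Q δ∣X δ∣Y) (∣X∣Y⇒∣Q⁴ P Q δ∣X δ∣Y)))
  where
  squareˡ : ∀ {a b} → BezoutCoprime a b → BezoutCoprime (a *G a) b
  squareˡ a⊥b = bezoutCoprime-*ˡ a⊥b a⊥b
  squareʳ : ∀ {a b} → BezoutCoprime a b → BezoutCoprime a (b *G b)
  squareʳ a⊥b = bezoutCoprime-*ʳ a⊥b a⊥b
  X⊥μ : BezoutCoprime (Xp P Q) ((1+iG *G 1+iG) *G (1+iG *G 1+iG))
  X⊥μ = squareʳ (squareʳ (odd⇒bezoutCoprime-1+i X-odd))
  P⁴⊥Q⁴ : BezoutCoprime ((P *G P) *G (P *G P)) ((Q *G Q) *G (Q *G Q))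
  P⁴⊥Q⁴ = squareʳ (squareʳ (squareˡ (squareˡ P⊥Q)))

coprime-to-even⇒odd : ∀ {P Q} → CoprimeG P Q → 1+iG ∣G Q → Odd P
coprime-to-even⇒odd {P} coprime 1+i∣Q with parity P
... | inj₁ 1+i∣P = ⊥-elim (1+i-nonunit (coprime 1+iG 1+i∣P 1+i∣Q))
... | inj₂ P-odd = P-odd

theorem4p19 : ∀ (P Q : GI) → InG P → InG Q → CoprimeG P Q → 1+iG ∣G Q →
                ((Xp P Q *G Xp P Q) +G iG *G (Yp P Q *G Yp P Q) ≡ 1+iG *G (Zp P Q *G Zp P Q))
                × CoprimeG (Xp P Q) (Yp P Q)
                × ¬ (Xp P Q *G Yp P Q *G Zp P Q ≡ 0G)
theorem4p19 P Q _ _ coprime 1+i∣Q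
  with parametrisation-odd (coprime-to-even⇒odd coprime 1+i∣Q) 1+i∣Q
... | X-odd , Y-odd , Z-odd =
  parametrisation-solves P Q ,
  parametrisation-coprime (coprime⇒bezoutCoprime coprime) X-odd ,
  odd⇒≢0G (odd-* (odd-* X-odd Y-odd) Z-odd)
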